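{- Let $\mathbf{C}$ be any category. Let $l:K\to L$, $t_L:L\to L'$, $t_K:K\to K'$, $l':K'\to L'$ be morphisms such that $t_L\circ l=l'\circ t_K$ is a pullback square. Let $m:L\to G_L$ and $\alpha:G_L\to L'$ satisfy $\alpha\circ m=t_L$ with $L\xleftarrow{1_L}L\xrightarrow{m}G_L$ a pullback of $L\xrightarrow{t_L}L'\xleftarrow{\alpha}G_L$, and let $G_L\xleftarrow{g_L}G_K\xrightarrow{u'}K'$ be a pullback of $G_L\xrightarrow{\alpha}L'\xleftarrow{l'}K'$. Then there exists a unique morphism $u:K\to G_K$ satisfying $t_K=u'\circ u$. Moreover: (1) the square $m\circ l=g_L\circ u$ (i.e., $L\xleftarrow{l}K\xrightarrow{u}G_K$ over $L\xrightarrow{m}G_L\xleftarrow{g_L}G_K$) and the square $u'\circ u=t_K\circ 1_K$ (i.e., $K\xleftarrow{1_K}K\xrightarrow{u}G_K$ over $K\xrightarrow{t_K}K'\xleftarrow{u'}G_K$) are pullbacks; and (2) if $m$ or $t_K$ is a monomorphism, then $u$ is a monomorphism. -}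

module Defs where

open import Level using (Level; _⊔_; suc)
open import Data.Product using (Σ; _×_)
open import Relation.Binary.PropositionalEquality using (_≡_)

record Category (o ℓ : Level) : Set (suc (o ⊔ ℓ)) where
  infixr 9 _∘_
  field
    Obj  : Set o
    Hom  : Obj → Obj → Set ℓ
    id   : ∀ {A} → Hom A A
    _∘_  : ∀ {A B C} → Hom B C → Hom A B → Hom A C
    identityˡ : ∀ {A B} {f : Hom A B} → id ∘ f ≡ f
    identityʳ : ∀ {A B} {f : Hom A B} → f ∘ id ≡ f
    assoc : ∀ {A B C D} {f : Hom A B} {g : Hom B C} {h : Hom C D} →
            (h ∘ g) ∘ f ≡ h ∘ (g ∘ f)

module _ {o ℓ} (𝒞 : Category o ℓ) where
  open Category 𝒞

  Mono : ∀ {A B} → Hom A B → Set (o ⊔ ℓ)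
  Mono {A} f = ∀ {X} (g h : Hom X A) → f ∘ g ≡ f ∘ h → g ≡ h

  IsPullback : ∀ {A B C P} (f : Hom A C) (g : Hom B C) (p₁ : Hom P A) (p₂ : Hom P B)
             → Set (o ⊔ ℓ)
  IsPullback {A} {B} {C} {P} f g p₁ p₂ =
    (f ∘ p₁ ≡ g ∘ p₂) ×
    (∀ {X} (a : Hom X A) (b : Hom X B) → f ∘ a ≡ g ∘ b →
       Σ (Hom X P) λ h → (p₁ ∘ h ≡ a) × (p₂ ∘ h ≡ b) ×
         (∀ (h' : Hom X P) → p₁ ∘ h' ≡ a → p₂ ∘ h' ≡ b → h' ≡ h))

-- By the two-pullback lemma, a square glued to the left of the pullback G_K is
-- a pullback exactly when the composite rectangle is one. The factorisation u of
-- (m ∘ l, t_K) through G_K gives two such rectangles: for the square over m the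
-- rectangle is the given pullback K, and for the square over t_K it is the
-- pullback of (1_L, m) along l. Uniqueness of u is then read off the second
-- square, and monicity follows because pullbacks preserve monos.
module Submission where

open import Defs
open import Data.Product using (Σ; _×_; _,_; proj₁; proj₂)
open import Data.Sum using (_⊎_; [_,_])
open import Relation.Binary.PropositionalEquality
  using (_≡_; refl; sym; trans; cong; subst₂; module ≡-Reasoning)

module Pullbacks {o ℓ} (𝒞 : Category o ℓ) where
  open Category 𝒞
  open ≡-Reasoning

  private variable
    A B C D P Q X : Obj

  pullˡ : ∀ {a : Hom B C} {b : Hom A B} {c : Hom A C} {f : Hom X A} →
          a ∘ b ≡ c → a ∘ (b ∘ f) ≡ c ∘ f
  pullˡ {f = f} e = trans (sym assoc) (cong (_∘ f) e)

  extendʳ : ∀ {a : Hom B C} {b : Hom A B} {c : Hom D C} {d : Hom A D} {f : Hom X A} →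
            a ∘ b ≡ c ∘ d → a ∘ (b ∘ f) ≡ c ∘ (d ∘ f)
  extendʳ e = trans (pullˡ e) assoc

  Mono-factorʳ : ∀ {f : Hom B C} {g : Hom A B} {h : Hom A C} →
                 f ∘ g ≡ h → Mono 𝒞 h → Mono 𝒞 g
  Mono-factorʳ {f = f} {g} {h} fg≡h h-mono x y gx≡gy = h-mono x y (begin
    h ∘ x        ≡⟨ pullˡ fg≡h ⟨
    f ∘ (g ∘ x)  ≡⟨ cong (f ∘_) gx≡gy ⟩
    f ∘ (g ∘ y)  ≡⟨ pullˡ fg≡h ⟩
    h ∘ y        ∎)

  module _ {f : Hom A C} {g : Hom B C} {p₁ : Hom P A} {p₂ : Hom P B} where

    pullback-swap : IsPullback 𝒞 f g p₁ p₂ → IsPullback 𝒞 g f p₂ p₁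
    pullback-swap (commute , universal) = sym commute , λ a b e →
      let (h , p₁h≡b , p₂h≡a , unique) = universal b a (sym e)
      in h , p₂h≡a , p₁h≡b , λ h' p₂h'≡a p₁h'≡b → unique h' p₁h'≡b p₂h'≡a

    pullback-jointly-monic : IsPullback 𝒞 f g p₁ p₂ → (x y : Hom X P) →
                             p₁ ∘ x ≡ p₁ ∘ y → p₂ ∘ x ≡ p₂ ∘ y → x ≡ y
    pullback-jointly-monic (commute , universal) x y p₁x≡p₁y p₂x≡p₂y =
      let (_ , _ , _ , unique) = universal (p₁ ∘ y) (p₂ ∘ y) (extendʳ commute)
      in trans (unique x p₁x≡p₁y p₂x≡p₂y) (sym (unique y refl refl))

    pullback-preserves-Mono : IsPullback 𝒞 f g p₁ p₂ → Mono 𝒞 f → Mono 𝒞 p₂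
    pullback-preserves-Mono pb@(commute , _) f-mono x y p₂x≡p₂y =
      pullback-jointly-monic pb x y (f-mono (p₁ ∘ x) (p₁ ∘ y) (begin
        f ∘ (p₁ ∘ x)  ≡⟨ extendʳ commute ⟩
        g ∘ (p₂ ∘ x)  ≡⟨ cong (g ∘_) p₂x≡p₂y ⟩
        g ∘ (p₂ ∘ y)  ≡⟨ extendʳ commute ⟨
        f ∘ (p₁ ∘ y)  ∎)) p₂x≡p₂y

  module _ {f : Hom A C} {g : Hom B C} {p : Hom A B} where

    pullback-id-factor : IsPullback 𝒞 f g id p → {x : Hom X B} {y : Hom X A} →
                         f ∘ y ≡ g ∘ x → p ∘ y ≡ x
    pullback-id-factor (_ , universal) {x} {y} e =
      let (h , h≡y , ph≡x , _) = universal y x e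
      in trans (cong (p ∘_) (trans (sym h≡y) identityˡ)) ph≡x

    pullback-id-∘ : (k : Hom D A) → IsPullback 𝒞 f g id p →
                    IsPullback 𝒞 (f ∘ k) g id (p ∘ k)
    pullback-id-∘ k pb@(commute , _) = commute-k , λ a b e →
        a , identityˡ , trans assoc (pullback-id-factor pb (trans (sym assoc) e))
          , λ h' h'≡a _ → trans (sym identityˡ) h'≡a
      where
      commute-k : (f ∘ k) ∘ id ≡ g ∘ (p ∘ k)
      commute-k = begin
        (f ∘ k) ∘ id  ≡⟨ identityʳ ⟩
        f ∘ k         ≡⟨ pullˡ identityʳ ⟨
        f ∘ (id ∘ k)  ≡⟨ extendʳ commute ⟩
        g ∘ (p ∘ k)   ∎

  unglue : ∀ {f : Hom A C} {g : Hom B C} {p₁ : Hom P A} {p₂ : Hom P B}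
             {h : Hom D A} {q₁ : Hom Q D} {q₂ : Hom Q P} →
           IsPullback 𝒞 f g p₁ p₂ → IsPullback 𝒞 (f ∘ h) g q₁ (p₂ ∘ q₂) →
           h ∘ q₁ ≡ p₁ ∘ q₂ → IsPullback 𝒞 h p₁ q₁ q₂
  unglue {P = P} {D = D} {Q = Q} {f = f} {g} {p₁} {p₂} {h} {q₁} {q₂} right (_ , outer) commute =
    commute , λ a b e →
      let (k , q₁k≡a , p₂q₂k≡p₂b , unique) = outer a (p₂ ∘ b) (outer-cone e)
      in k , q₁k≡a , q₂-factor k e q₁k≡a (trans (sym assoc) p₂q₂k≡p₂b)
           , λ k' q₁k'≡a q₂k'≡b → unique k' q₁k'≡a (trans assoc (cong (p₂ ∘_) q₂k'≡b))
    where
    outer-cone : {a : Hom X D} {b : Hom X P} →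
                 h ∘ a ≡ p₁ ∘ b → (f ∘ h) ∘ a ≡ g ∘ (p₂ ∘ b)
    outer-cone {a = a} {b} e = begin
      (f ∘ h) ∘ a   ≡⟨ assoc ⟩
      f ∘ (h ∘ a)   ≡⟨ cong (f ∘_) e ⟩
      f ∘ (p₁ ∘ b)  ≡⟨ extendʳ (proj₁ right) ⟩
      g ∘ (p₂ ∘ b)  ∎

    q₂-factor : {a : Hom X D} {b : Hom X P} (k : Hom X Q) → h ∘ a ≡ p₁ ∘ b →
                q₁ ∘ k ≡ a → p₂ ∘ (q₂ ∘ k) ≡ p₂ ∘ b → q₂ ∘ k ≡ b
    q₂-factor {a = a} {b} k e q₁k≡a = pullback-jointly-monic right (q₂ ∘ k) b (begin
      p₁ ∘ (q₂ ∘ k)  ≡⟨ extendʳ commute ⟨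
      h ∘ (q₁ ∘ k)   ≡⟨ cong (h ∘_) q₁k≡a ⟩
      h ∘ a          ≡⟨ e ⟩
      p₁ ∘ b         ∎)

lemma2 : ∀ {o ℓ} (𝒞 : Category o ℓ) → let open Category 𝒞 in
         ∀ {K L L' K' GL GK : Obj}
           (l : Hom K L) (tL : Hom L L') (tK : Hom K K') (l' : Hom K' L')
           (m : Hom L GL) (α : Hom GL L') (gL : Hom GK GL) (u' : Hom GK K') →
         IsPullback 𝒞 tL l' l tK →
         α ∘ m ≡ tL →
         IsPullback 𝒞 tL α id m →
         IsPullback 𝒞 α l' gL u' →
         Σ (Hom K GK) λ u →
           (tK ≡ u' ∘ u) ×
           (∀ (v : Hom K GK) → tK ≡ u' ∘ v → v ≡ u) ×
           IsPullback 𝒞 m gL l u ×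
           IsPullback 𝒞 tK u' id u ×
           ((Mono 𝒞 m ⊎ Mono 𝒞 tK) → Mono 𝒞 u)
lemma2 𝒞 l tL tK l' m α gL u' outer@(tLl≡l'tK , _) αm≡tL m-pullback right =
  let (u , gLu≡ml , u'u≡tK , _) = proj₂ right (m ∘ l) tK (trans (pullˡ αm≡tL) tLl≡l'tK)
      left : IsPullback 𝒞 m gL l u
      left = unglue right (subst₂ (λ f p → IsPullback 𝒞 f l' l p) (sym αm≡tL) (sym u'u≡tK) outer)
                    (sym gLu≡ml)
      top : IsPullback 𝒞 tK u' id u
      top = unglue (pullback-swap right)
                   (subst₂ (λ f p → IsPullback 𝒞 f α id p) tLl≡l'tK (sym gLu≡ml)
                           (pullback-id-∘ l m-pullback))
                   (trans identityʳ (sym u'u≡tK))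
  in u , sym u'u≡tK
       , (λ v tK≡u'v → sym (trans (sym identityʳ) (pullback-id-factor top (trans identityʳ tK≡u'v))))
       , left , top
       , [ pullback-preserves-Mono left , Mono-factorʳ u'u≡tK ]
  where
  open Category 𝒞
  open Pullbacks 𝒞
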